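{- Let $k\ge4$ be a power of $2$. There exists a family $\mathcal{Q}\subset\binom{[2k-1]}{k-1}$ with $|\mathcal{Q}|=\frac12\left(\binom{2k-1}{k-1}-3\right)$ such that, writing $d'(i)$ for the number of members of $\mathcal{Q}$ containing $i\in[2k-1]$, $$d'(1)-1=d'(2)-1=\dots=d'(3k/2)-1=d'(3k/2+1)=\dots=d'(2k-1),$$ and such that none of the sets $A_1=[k+1,2k-1]$, $A_2=[1,k/2]\cup[3k/2+1,2k-1]$, $A_3=[k/2+1,k]\cup[3k/2+1,2k-1]$ belongs to $\mathcal{Q}$.
   Context: $[m]=\{1,\dots,m\}$, $[a,b]=\{a,a+1,\dots,b\}$ for integers $a\le b$, and $\binom{X}{t}$ is the set of $t$-element subsets of $X$. -}

module Defs where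

open import Data.Nat using (ℕ; suc; _+_; _*_; _∸_; _≤_; _≤?_)
open import Data.Nat.DivMod using (_/_)
open import Data.Bool using (Bool; _∧_)
open import Data.Fin using (Fin; toℕ)
open import Data.Fin.Subset using (Subset; inside; outside)
open import Data.Fin.Subset.Properties using (_∈?_)
open import Data.Vec using (tabulate)
open import Data.List using (List; length; filter)
open import Relation.Nullary.Decidable using (⌊_⌋)

-- Convention: the ground set [m] = {1,…,m} is represented by Fin m,
-- where i : Fin m stands for the natural number toℕ i + 1.
label : ∀ {m} → Fin m → ℕ
label i = suc (toℕ i)

fromPred : ∀ {m} → (ℕ → Bool) → Subset m
fromPred p = tabulate (λ i → Data.Bool.if p (label i) then inside else outside)

inInterval : ℕ → ℕ → ℕ → Bool
inInterval a b x = ⌊ a ≤? x ⌋ ∧ ⌊ x ≤? b ⌋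

degree : ∀ {m} → List (Subset m) → Fin m → ℕ
degree Q i = length (filter (λ S → i ∈? S) Q)

A₁ : (k : ℕ) → Subset (2 * k ∸ 1)
A₁ k = fromPred (inInterval (k + 1) (2 * k ∸ 1))

A₂ : (k : ℕ) → Subset (2 * k ∸ 1)
A₂ k = fromPred (λ x → inInterval 1 (k / 2) x Data.Bool.∨ inInterval (3 * k / 2 + 1) (2 * k ∸ 1) x)

A₃ : (k : ℕ) → Subset (2 * k ∸ 1)
A₃ k = fromPred (λ x → inInterval (k / 2 + 1) k x Data.Bool.∨ inInterval (3 * k / 2 + 1) (2 * k ∸ 1) x)

module Submission where

-- The family is built by doubling k.  Split [4k-1] into the 2k-1 pairs {2j-1, 2j} and the
-- extra point 4k-1, and lift T ⊆ [2k-1] to the union of the pairs indexed by T plus the extra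
-- point.  The family for 2k consists of the lifts of the members of the family Q for k, and of
-- half of the (2k-1)-subsets of [4k-1] that are not lifts: those with chosen = true.  For every
-- point w there is an involution that fixes the pair of w and flips chosen (swap the first split
-- pair other than w's, or, if there is none, complement all pairs other than w's), so w lies in
-- exactly half of the unlifted sets through it.  Hence the identities
--   2 d'(i) + 1 = 2 d'(j) + 3 = #{(k-1)-sets through a point}   (i ≤ 3k/2 < j),
--   2 |Q| + 3 = C(2k-1, k-1)
-- pass from k to 2k, and A₁, A₂, A₃ for 2k are the lifts of those for k, so they stay outside.
-- The recursion starts from k = 2 with Q empty.

open import Data.Bool using (Bool; true; false; not; _∧_; _∨_; _xor_; if_then_else_; T)
open import Data.Bool.Properties
  using (∧-zeroʳ; ∧-identityʳ; not-involutive; not-distribˡ-xor; not-distribʳ-xor; T-∧)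
import Data.Bool.Properties as Bool
open import Data.Empty using (⊥)
open import Data.Fin using (Fin; zero; suc; fromℕ; toℕ; inject₁)
open import Data.Fin.Properties using (toℕ<n; toℕ-fromℕ; toℕ-inject₁)
open import Data.Fin.Subset using (Subset; ∣_∣)
open import Data.Fin.Subset.Properties using (_∈?_)
open import Data.List using (List; []; _∷_; _++_; map; filter; length)
open import Data.List.Membership.Propositional using (_∈_; _∉_)
open import Data.List.Membership.Propositional.Properties using (∈-map⁻; ∈-filter⁻; ∈-++⁻)
open import Data.List.Relation.Unary.All using (All; [])
import Data.List.Relation.Unary.All as All
import Data.List.Relation.Unary.All.Properties as All
open import Data.List.Relation.Unary.AllPairs using ([]; _∷_)
open import Data.List.Relation.Unary.Unique.Propositional using (Unique)
import Data.List.Relation.Unary.Unique.Propositional.Properties as Unique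
open import Data.Nat using (ℕ; zero; suc; _+_; _*_; _∸_; _^_; _/_; _≤_; _<_; _>_; _≤?_; _<?_; s≤s; _≡ᵇ_; _<ᵇ_)
open import Data.Nat.Combinatorics using (_C_; nCk+nC[k+1]≡[n+1]C[k+1])
open import Data.Nat.DivMod using (m*n/n≡m)
open import Data.Nat.Properties using (+-assoc; +-comm; +-identityʳ; +-suc; +-cancelˡ-≡; +-commutativeSemigroup)
import Data.Nat.Properties as ℕ
open import Data.Nat.Tactic.RingSolver using (solve-∀)
open import Algebra.Properties.CommutativeSemigroup +-commutativeSemigroup
  using () renaming (interchange to +-interchange)
open import Data.Product using (Σ; _×_; _,_; ∃; proj₁; proj₂)
open import Data.Sum using (inj₁; inj₂)
open import Data.Vec using (Vec; []; _∷_; _∷ʳ_; lookup; tabulate)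
open import Data.Vec.Properties using (≡-dec; ∷-injectiveˡ; ∷-injectiveʳ; tabulate-cong)
open import Function.Base using (_∘_)
open import Function.Bundles using (mk⇔; Equivalence)
open import Level using (0ℓ)
open import Relation.Binary.Definitions using (DecidableEquality)
open import Relation.Binary.PropositionalEquality
open import Relation.Nullary using (does; ¬_)
open import Relation.Nullary.Decidable using (does-⇔; dec-true; dec-false; isYes≗does; ¬?; T?)
open import Relation.Unary using (Pred; Decidable)

open import Defs

-- Sums over all subsets of [m]

𝟙 : Bool → ℕ
𝟙 true  = 1
𝟙 false = 0

∑ : ∀ m → (Subset m → ℕ) → ℕ
∑ zero    f = f []
∑ (suc m) f = ∑ m (λ S → f (true ∷ S)) + ∑ m (λ S → f (false ∷ S))

∑-cong : ∀ m {f g : Subset m → ℕ} → (∀ S → f S ≡ g S) → ∑ m f ≡ ∑ m g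
∑-cong zero    f≗g = f≗g []
∑-cong (suc m) f≗g = cong₂ _+_ (∑-cong m (λ S → f≗g (true ∷ S))) (∑-cong m (λ S → f≗g (false ∷ S)))

∑-zero : ∀ m {f : Subset m → ℕ} → (∀ S → f S ≡ 0) → ∑ m f ≡ 0
∑-zero zero    f≗0 = f≗0 []
∑-zero (suc m) f≗0 = cong₂ _+_ (∑-zero m (λ S → f≗0 (true ∷ S))) (∑-zero m (λ S → f≗0 (false ∷ S)))

∑-distrib-+ : ∀ m (f g : Subset m → ℕ) → ∑ m (λ S → f S + g S) ≡ ∑ m f + ∑ m g
∑-distrib-+ zero    f g = refl
∑-distrib-+ (suc m) f g = trans
  (cong₂ _+_ (∑-distrib-+ m (λ S → f (true ∷ S)) (λ S → g (true ∷ S)))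
             (∑-distrib-+ m (λ S → f (false ∷ S)) (λ S → g (false ∷ S))))
  (+-interchange (∑ m (λ S → f (true ∷ S))) (∑ m (λ S → g (true ∷ S)))
                 (∑ m (λ S → f (false ∷ S))) (∑ m (λ S → g (false ∷ S))))

∑-comm : ∀ m n (h : Subset m → Subset n → ℕ) →
         ∑ m (λ S → ∑ n (h S)) ≡ ∑ n (λ T → ∑ m (λ S → h S T))
∑-comm zero    n h = refl
∑-comm (suc m) n h = trans (cong₂ _+_ (∑-comm m n _) (∑-comm m n _))
  (sym (∑-distrib-+ n (λ T → ∑ m (λ S → h (true ∷ S) T)) (λ T → ∑ m (λ S → h (false ∷ S) T))))

_≟ˢ_ : ∀ {m} → DecidableEquality (Subset m)
_≟ˢ_ = ≡-dec Bool._≟_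

∑-δ : ∀ m (U : Subset m) (f : Subset m → ℕ) → ∑ m (λ T → if does (T ≟ˢ U) then f T else 0) ≡ f U
∑-δ zero    []          f = refl
∑-δ (suc m) (true ∷ U)  f = trans (cong₂ _+_ (∑-δ m U (λ T → f (true ∷ T))) (∑-zero m (λ _ → refl))) (+-identityʳ _)
∑-δ (suc m) (false ∷ U) f = cong₂ _+_ (∑-zero m (λ _ → refl)) (∑-δ m U (λ T → f (false ∷ T)))

∑-involution : ∀ m (φ : Subset m → Subset m) → (∀ S → φ (φ S) ≡ S) →
               ∀ f → ∑ m (λ S → f (φ S)) ≡ ∑ m f
∑-involution m φ φ∘φ≗id f = begin
  ∑ m (λ S → f (φ S))                                             ≡⟨ ∑-cong m (λ S → sym (∑-δ m (φ S) f)) ⟩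
  ∑ m (λ S → ∑ m (λ T → if does (T ≟ˢ φ S) then f T else 0))     ≡⟨ ∑-comm m m _ ⟩
  ∑ m (λ T → ∑ m (λ S → if does (T ≟ˢ φ S) then f T else 0))     ≡⟨ ∑-cong m (λ T → ∑-cong m (λ S →
                                                                       cong (λ b → if b then f T else 0) (transpose S T))) ⟩
  ∑ m (λ T → ∑ m (λ S → if does (S ≟ˢ φ T) then f T else 0))     ≡⟨ ∑-cong m (λ T → ∑-δ m (φ T) (λ _ → f T)) ⟩
  ∑ m f                                                           ∎
  where
  open ≡-Reasoning
  transpose : ∀ S T → does (T ≟ˢ φ S) ≡ does (S ≟ˢ φ T)
  transpose S T =
    does-⇔ (mk⇔ (λ { refl → sym (φ∘φ≗id S) }) (λ { refl → sym (φ∘φ≗id T) })) (T ≟ˢ φ S) (S ≟ˢ φ T)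

∑-size≡C : ∀ m r → ∑ m (λ S → 𝟙 (∣ S ∣ ≡ᵇ r)) ≡ m C r
∑-size≡C zero    zero    = refl
∑-size≡C zero    (suc r) = refl
∑-size≡C (suc m) zero    = cong₂ _+_ (∑-zero m (λ _ → refl)) (∑-size≡C m zero)
∑-size≡C (suc m) (suc r) =
  trans (cong₂ _+_ (∑-size≡C m r) (∑-size≡C m (suc r))) (nCk+nC[k+1]≡[n+1]C[k+1] m r)

∑-empty-∋ : ∀ m (i : Fin m) → ∑ m (λ S → 𝟙 ((∣ S ∣ ≡ᵇ 0) ∧ lookup S i)) ≡ 0
∑-empty-∋ (suc m) zero    = cong₂ _+_ (∑-zero m (λ _ → refl)) (∑-zero m (λ S → cong 𝟙 (∧-zeroʳ _)))
∑-empty-∋ (suc m) (suc i) = cong₂ _+_ (∑-zero m (λ _ → refl)) (∑-empty-∋ m i)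

∑-size-∋≡C : ∀ m r (i : Fin (suc m)) → ∑ (suc m) (λ S → 𝟙 ((∣ S ∣ ≡ᵇ suc r) ∧ lookup S i)) ≡ m C r
∑-size-∋≡C m r zero = trans
  (cong₂ _+_ (∑-cong m (λ S → cong 𝟙 (∧-identityʳ _))) (∑-zero m (λ S → cong 𝟙 (∧-zeroʳ _))))
  (trans (+-identityʳ _) (∑-size≡C m r))
∑-size-∋≡C (suc m) zero    (suc i) = cong₂ _+_ (∑-empty-∋ (suc m) i) (∑-size-∋≡C m zero i)
∑-size-∋≡C (suc m) (suc r) (suc i) =
  trans (cong₂ _+_ (∑-size-∋≡C m r i) (∑-size-∋≡C m (suc r) i)) (nCk+nC[k+1]≡[n+1]C[k+1] m r)

countᵇ : ∀ {A : Set} → (A → Bool) → List A → ℕ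
countᵇ p []       = 0
countᵇ p (x ∷ xs) = 𝟙 (p x) + countᵇ p xs

module _ {A : Set} where

  length-filter≡countᵇ : ∀ {P : Pred A 0ℓ} (P? : Decidable P) xs →
                         length (filter P? xs) ≡ countᵇ (λ x → does (P? x)) xs
  length-filter≡countᵇ P? []       = refl
  length-filter≡countᵇ P? (x ∷ xs) with does (P? x)
  ... | true  = cong suc (length-filter≡countᵇ P? xs)
  ... | false = length-filter≡countᵇ P? xs

  countᵇ-filter : ∀ {P : Pred A 0ℓ} (P? : Decidable P) (p : A → Bool) xs →
                  countᵇ p (filter P? xs) ≡ countᵇ (λ x → does (P? x) ∧ p x) xs
  countᵇ-filter P? p []       = refl
  countᵇ-filter P? p (x ∷ xs) with does (P? x)
  ... | true  = cong (𝟙 (p x) +_) (countᵇ-filter P? p xs)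
  ... | false = countᵇ-filter P? p xs

  countᵇ-cong : ∀ {p q : A → Bool} → (∀ x → p x ≡ q x) → ∀ xs → countᵇ p xs ≡ countᵇ q xs
  countᵇ-cong p≗q []       = refl
  countᵇ-cong p≗q (x ∷ xs) = cong₂ _+_ (cong 𝟙 (p≗q x)) (countᵇ-cong p≗q xs)

  countᵇ-++ : ∀ (p : A → Bool) xs ys → countᵇ p (xs ++ ys) ≡ countᵇ p xs + countᵇ p ys
  countᵇ-++ p []       ys = refl
  countᵇ-++ p (x ∷ xs) ys = trans (cong (𝟙 (p x) +_) (countᵇ-++ p xs ys)) (sym (+-assoc (𝟙 (p x)) _ _))

  countᵇ-map : ∀ {B : Set} (p : B → Bool) (f : A → B) xs → countᵇ p (map f xs) ≡ countᵇ (λ x → p (f x)) xs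
  countᵇ-map p f []       = refl
  countᵇ-map p f (x ∷ xs) = cong (𝟙 (p (f x)) +_) (countᵇ-map p f xs)

subsets : ∀ m → List (Subset m)
subsets zero    = [] ∷ []
subsets (suc m) = map (true ∷_) (subsets m) ++ map (false ∷_) (subsets m)

countᵇ-subsets : ∀ m (p : Subset m → Bool) → countᵇ p (subsets m) ≡ ∑ m (λ S → 𝟙 (p S))
countᵇ-subsets zero    p = +-identityʳ _
countᵇ-subsets (suc m) p = begin
  countᵇ p (map (true ∷_) (subsets m) ++ map (false ∷_) (subsets m))
    ≡⟨ countᵇ-++ p (map (true ∷_) (subsets m)) (map (false ∷_) (subsets m)) ⟩
  countᵇ p (map (true ∷_) (subsets m)) + countᵇ p (map (false ∷_) (subsets m))
    ≡⟨ cong₂ _+_ (countᵇ-map p (true ∷_) (subsets m)) (countᵇ-map p (false ∷_) (subsets m)) ⟩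
  countᵇ (λ S → p (true ∷ S)) (subsets m) + countᵇ (λ S → p (false ∷ S)) (subsets m)
    ≡⟨ cong₂ _+_ (countᵇ-subsets m (λ S → p (true ∷ S))) (countᵇ-subsets m (λ S → p (false ∷ S))) ⟩
  ∑ (suc m) (λ S → 𝟙 (p S)) ∎
  where open ≡-Reasoning

subsets-unique : ∀ m → Unique (subsets m)
subsets-unique zero    = [] ∷ []
subsets-unique (suc m) = Unique.++⁺ (Unique.map⁺ ∷-injectiveʳ (subsets-unique m))
                                    (Unique.map⁺ ∷-injectiveʳ (subsets-unique m)) disjoint
  where
  disjoint : ∀ {S} → S ∈ map (true ∷_) (subsets m) × S ∈ map (false ∷_) (subsets m) → ⊥
  disjoint (S∈ , S∈′) with ∈-map⁻ (true ∷_) S∈ | ∈-map⁻ (false ∷_) S∈′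
  ... | _ , _ , refl | _ , _ , ()

double : ℕ → ℕ
double zero    = zero
double (suc n) = suc (suc (double n))

double≡+ : ∀ n → double n ≡ n + n
double≡+ zero    = refl
double≡+ (suc n) = cong suc (trans (cong suc (double≡+ n)) (sym (+-suc n n)))

double-distrib-+ : ∀ m n → double (m + n) ≡ double m + double n
double-distrib-+ zero    n = refl
double-distrib-+ (suc m) n = cong (λ x → suc (suc x)) (double-distrib-+ m n)

double-injective : ∀ {m n} → double m ≡ double n → m ≡ n
double-injective {zero}  {zero}  eq = refl
double-injective {suc m} {suc n} eq = cong suc (double-injective (ℕ.suc-injective (ℕ.suc-injective eq)))

double-≡ᵇ : ∀ m n → (double m ≡ᵇ double n) ≡ (m ≡ᵇ n)
double-≡ᵇ zero    zero    = refl
double-≡ᵇ zero    (suc n) = refl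
double-≡ᵇ (suc m) zero    = refl
double-≡ᵇ (suc m) (suc n) = double-≡ᵇ m n

double-≢ᵇ-odd : ∀ m n → (double m ≡ᵇ suc (double n)) ≡ false
double-≢ᵇ-odd zero    n       = refl
double-≢ᵇ-odd (suc m) zero    = refl
double-≢ᵇ-odd (suc m) (suc n) = double-≢ᵇ-odd m n

odd-≢ᵇ-double : ∀ m n → (suc (double m) ≡ᵇ double n) ≡ false
odd-≢ᵇ-double m       zero    = refl
odd-≢ᵇ-double zero    (suc n) = refl
odd-≢ᵇ-double (suc m) (suc n) = odd-≢ᵇ-double m n

double-<ᵇ : ∀ q t → (double q <ᵇ double t) ≡ (q <ᵇ t)
double-<ᵇ zero    zero    = refl
double-<ᵇ zero    (suc t) = refl
double-<ᵇ (suc q) zero    = refl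
double-<ᵇ (suc q) (suc t) = double-<ᵇ q t

odd-<ᵇ : ∀ q t → (suc (double q) <ᵇ double t) ≡ (q <ᵇ t)
odd-<ᵇ zero    zero    = refl
odd-<ᵇ zero    (suc t) = refl
odd-<ᵇ (suc q) zero    = refl
odd-<ᵇ (suc q) (suc t) = odd-<ᵇ q t

≤⇒<ᵇ-false : ∀ {t q} → t ≤ q → (q <ᵇ t) ≡ false
≤⇒<ᵇ-false {t} {q} t≤q = dec-false (q ℕ.<? t) (ℕ.≤⇒≯ t≤q)

2*≡double : ∀ n → 2 * n ≡ double n
2*≡double n = trans (cong (n +_) (+-identityʳ n)) (sym (double≡+ n))

double-/2 : ∀ n → double n / 2 ≡ n
double-/2 n = trans (cong (_/ 2) (trans (sym (2*≡double n)) (ℕ.*-comm 2 n))) (m*n/n≡m n 2)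

double-mono-≤ : ∀ {m n} → m ≤ n → double m ≤ double n
double-mono-≤ {m} {n} m≤n = subst₂ _≤_ (sym (double≡+ m)) (sym (double≡+ n)) (ℕ.+-mono-≤ m≤n m≤n)

3*-double : ∀ h → 3 * double h ≡ double (3 * h)
3*-double h = trans (cong (3 *_) (double≡+ h)) (trans (ℕ.*-distribˡ-+ 3 h h) (sym (double≡+ (3 * h))))

double≤3* : ∀ h → double h ≤ 3 * h
double≤3* h = subst (double h ≤_) (trans (cong (_+ h) (double≡+ h)) (h+h+h≡3*h h)) (ℕ.m≤m+n (double h) h)
  where
  h+h+h≡3*h : ∀ h → h + h + h ≡ 3 * h
  h+h+h≡3*h = solve-∀

3h≤4h-1 : ∀ a → 3 * suc a ≤ suc (double (suc (double a)))
3h≤4h-1 a = subst (3 * suc a ≤_) (sym eq) (ℕ.m≤m+n (3 * suc a) a)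
  where
  4a+3≡3[a+1]+a : ∀ a → suc (suc (a + a) + suc (a + a)) ≡ 3 * suc a + a
  4a+3≡3[a+1]+a = solve-∀
  eq : suc (double (suc (double a))) ≡ 3 * suc a + a
  eq = trans (cong suc (trans (double≡+ (suc (double a))) (cong (λ x → suc x + suc x) (double≡+ a))))
             (4a+3≡3[a+1]+a a)

3h≤4h-2 : ∀ a → 3 * suc (suc a) ≤ double (suc (double (suc a)))
3h≤4h-2 a = subst (3 * suc (suc a) ≤_) (sym eq) (ℕ.m≤m+n (3 * suc (suc a)) a)
  where
  4a+6≡3[a+2]+a : ∀ a → suc (suc a + suc a) + suc (suc a + suc a) ≡ 3 * suc (suc a) + a
  4a+6≡3[a+2]+a = solve-∀
  eq : double (suc (double (suc a))) ≡ 3 * suc (suc a) + a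
  eq = trans (double≡+ (suc (double (suc a))))
             (trans (cong (λ x → suc x + suc x) (double≡+ (suc a))) (4a+6≡3[a+2]+a a))

2*double∸1 : ∀ h → 2 * double (suc h) ∸ 1 ≡ suc (double (suc (double h)))
2*double∸1 h = cong (_∸ 1) (2*≡double (double (suc h)))

-- Lifting from [g] to [2g+1]

-- The ground set [2g+1] is split into the pairs {2j, 2j+1} (j < g) and the extra point 2g;
-- a block e : Fin (suc g) is one of the pairs, or (for e = fromℕ g) the extra point.
Paired : ℕ → Set
Paired g = Subset (suc (double g))

half : ∀ {m} → Fin (double m) → Fin m
half {suc m} zero          = zero
half {suc m} (suc zero)    = zero
half {suc m} (suc (suc i)) = suc (half i)

lift : ∀ {g} → Vec Bool g → Bool → Paired g
lift []      x = x ∷ []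
lift (y ∷ T) x = y ∷ y ∷ lift T x

isLifted : ∀ {g} → Paired g → Bool
isLifted {zero}  (_ ∷ [])    = true
isLifted {suc g} (a ∷ b ∷ S) = not (a xor b) ∧ isLifted S

lookup-lift-∷ʳ : ∀ {g} (T : Vec Bool g) x (b : Fin (double (suc g))) →
                 lookup (lift T x ∷ʳ x) b ≡ lookup (T ∷ʳ x) (half b)
lookup-lift-∷ʳ []      x zero          = refl
lookup-lift-∷ʳ []      x (suc zero)    = refl
lookup-lift-∷ʳ (y ∷ T) x zero          = refl
lookup-lift-∷ʳ (y ∷ T) x (suc zero)    = refl
lookup-lift-∷ʳ (y ∷ T) x (suc (suc b)) = lookup-lift-∷ʳ T x b

lift-injective : ∀ {g} (T U : Vec Bool g) x → lift T x ≡ lift U x → T ≡ U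
lift-injective []      []      x eq = refl
lift-injective (y ∷ T) (z ∷ U) x eq =
  cong₂ _∷_ (∷-injectiveˡ eq) (lift-injective T U x (∷-injectiveʳ (∷-injectiveʳ eq)))

isLifted-lift : ∀ {g} (T : Vec Bool g) x → isLifted (lift T x) ≡ true
isLifted-lift []          x = refl
isLifted-lift (true ∷ T)  x = isLifted-lift T x
isLifted-lift (false ∷ T) x = isLifted-lift T x

∣lift-true∣ : ∀ {g} (T : Vec Bool g) → ∣ lift T true ∣ ≡ suc (double ∣ T ∣)
∣lift-true∣ []          = refl
∣lift-true∣ (true ∷ T)  = cong (λ n → suc (suc n)) (∣lift-true∣ T)
∣lift-true∣ (false ∷ T) = ∣lift-true∣ T

∣lift-false∣ : ∀ {g} (T : Vec Bool g) → ∣ lift T false ∣ ≡ double ∣ T ∣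
∣lift-false∣ []          = refl
∣lift-false∣ (true ∷ T)  = cong (λ n → suc (suc n)) (∣lift-false∣ T)
∣lift-false∣ (false ∷ T) = ∣lift-false∣ T

∑-lifted : ∀ g (f : Paired g → ℕ) →
           ∑ (suc (double g)) (λ S → if isLifted S then f S else 0) ≡ ∑ g (λ T → f (lift T true) + f (lift T false))
∑-lifted zero    f = refl
∑-lifted (suc g) f = cong₂ _+_
  (trans (cong₂ _+_ (∑-lifted g (λ S → f (true ∷ true ∷ S))) (∑-zero (suc (double g)) (λ _ → refl))) (+-identityʳ _))
  (cong₂ _+_ (∑-zero (suc (double g)) (λ _ → refl)) (∑-lifted g (λ S → f (false ∷ false ∷ S))))

-- An involution flipping chosen

splitOutside : ∀ {g} → Fin (suc g) → Paired g → Bool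
splitOutside {zero}  zero    _           = false
splitOutside {suc g} zero    (a ∷ b ∷ S) = splitOutside (fromℕ g) S
splitOutside {suc g} (suc e) (a ∷ b ∷ S) = (a xor b) ∨ splitOutside e S

swapFirstSplit : ∀ {g} → Fin (suc g) → Paired g → Paired g
swapFirstSplit {zero}  zero    S           = S
swapFirstSplit {suc g} zero    (a ∷ b ∷ S) = a ∷ b ∷ swapFirstSplit (fromℕ g) S
swapFirstSplit {suc g} (suc e) (a ∷ b ∷ S) = if a xor b then b ∷ a ∷ S else a ∷ b ∷ swapFirstSplit e S

complementOutside : ∀ {g} → Fin (suc g) → Paired g → Paired g
complementOutside {zero}  zero    S           = S
complementOutside {suc g} zero    (a ∷ b ∷ S) = a ∷ b ∷ complementOutside (fromℕ g) S
complementOutside {suc g} (suc e) (a ∷ b ∷ S) = not a ∷ not b ∷ complementOutside e S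

toggle : ∀ {g} → Fin (suc g) → Paired g → Paired g
toggle e S = if splitOutside e S then swapFirstSplit e S else complementOutside e S

oddSplits : ∀ {g} → Paired g → Bool
oddSplits {zero}  _           = false
oddSplits {suc g} (a ∷ b ∷ S) = (a ∧ not b) xor oddSplits S

firstUniform : ∀ {g} → Paired g → Bool
firstUniform {zero}  _           = false
firstUniform {suc g} (a ∷ b ∷ S) = if a xor b then firstUniform S else a

-- Swapping a split pair flips oddSplits; complementing uniform pairs flips firstUniform.
chosen : ∀ {g} → Paired g → Bool
chosen S = oddSplits S xor firstUniform S

xor-not-not : ∀ a b → not a xor not b ≡ a xor b
xor-not-not a b = trans (sym (not-distribˡ-xor a (not b)))
                        (trans (cong not (sym (not-distribʳ-xor a b))) (not-involutive (a xor b)))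

swapFirstSplit-involutive : ∀ {g} (e : Fin (suc g)) S → swapFirstSplit e (swapFirstSplit e S) ≡ S
swapFirstSplit-involutive {zero}  zero    S                   = refl
swapFirstSplit-involutive {suc g} zero    (a ∷ b ∷ S)         = cong (λ S′ → a ∷ b ∷ S′) (swapFirstSplit-involutive (fromℕ g) S)
swapFirstSplit-involutive {suc g} (suc e) (true ∷ true ∷ S)   = cong (λ S′ → true ∷ true ∷ S′) (swapFirstSplit-involutive e S)
swapFirstSplit-involutive {suc g} (suc e) (false ∷ false ∷ S) = cong (λ S′ → false ∷ false ∷ S′) (swapFirstSplit-involutive e S)
swapFirstSplit-involutive {suc g} (suc e) (true ∷ false ∷ S)  = refl
swapFirstSplit-involutive {suc g} (suc e) (false ∷ true ∷ S)  = refl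

swapFirstSplit-splitOutside : ∀ {g} (e : Fin (suc g)) S → splitOutside e (swapFirstSplit e S) ≡ splitOutside e S
swapFirstSplit-splitOutside {zero}  zero    S                   = refl
swapFirstSplit-splitOutside {suc g} zero    (a ∷ b ∷ S)         = swapFirstSplit-splitOutside (fromℕ g) S
swapFirstSplit-splitOutside {suc g} (suc e) (true ∷ true ∷ S)   = swapFirstSplit-splitOutside e S
swapFirstSplit-splitOutside {suc g} (suc e) (false ∷ false ∷ S) = swapFirstSplit-splitOutside e S
swapFirstSplit-splitOutside {suc g} (suc e) (true ∷ false ∷ S)  = refl
swapFirstSplit-splitOutside {suc g} (suc e) (false ∷ true ∷ S)  = refl

swapFirstSplit-isLifted : ∀ {g} (e : Fin (suc g)) S → isLifted (swapFirstSplit e S) ≡ isLifted S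
swapFirstSplit-isLifted {zero}  zero    S                   = refl
swapFirstSplit-isLifted {suc g} zero    (a ∷ b ∷ S)         = cong (not (a xor b) ∧_) (swapFirstSplit-isLifted (fromℕ g) S)
swapFirstSplit-isLifted {suc g} (suc e) (true ∷ true ∷ S)   = swapFirstSplit-isLifted e S
swapFirstSplit-isLifted {suc g} (suc e) (false ∷ false ∷ S) = swapFirstSplit-isLifted e S
swapFirstSplit-isLifted {suc g} (suc e) (true ∷ false ∷ S)  = refl
swapFirstSplit-isLifted {suc g} (suc e) (false ∷ true ∷ S)  = refl

swapFirstSplit-size : ∀ {g} (e : Fin (suc g)) S → ∣ swapFirstSplit e S ∣ ≡ ∣ S ∣
swapFirstSplit-size {zero}  zero    S                   = refl
swapFirstSplit-size {suc g} zero    (true ∷ true ∷ S)   = cong (λ n → suc (suc n)) (swapFirstSplit-size (fromℕ g) S)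
swapFirstSplit-size {suc g} zero    (true ∷ false ∷ S)  = cong suc (swapFirstSplit-size (fromℕ g) S)
swapFirstSplit-size {suc g} zero    (false ∷ true ∷ S)  = cong suc (swapFirstSplit-size (fromℕ g) S)
swapFirstSplit-size {suc g} zero    (false ∷ false ∷ S) = swapFirstSplit-size (fromℕ g) S
swapFirstSplit-size {suc g} (suc e) (true ∷ true ∷ S)   = cong (λ n → suc (suc n)) (swapFirstSplit-size e S)
swapFirstSplit-size {suc g} (suc e) (false ∷ false ∷ S) = swapFirstSplit-size e S
swapFirstSplit-size {suc g} (suc e) (true ∷ false ∷ S)  = refl
swapFirstSplit-size {suc g} (suc e) (false ∷ true ∷ S)  = refl

swapFirstSplit-lookup : ∀ {g} (b : Fin (double (suc g))) S x →
                        lookup (swapFirstSplit (half b) S ∷ʳ x) b ≡ lookup (S ∷ʳ x) b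
swapFirstSplit-lookup {zero}  zero          (a ∷ [])                x = refl
swapFirstSplit-lookup {zero}  (suc zero)    (a ∷ [])                x = refl
swapFirstSplit-lookup {suc g} zero          (a ∷ b ∷ S)             x = refl
swapFirstSplit-lookup {suc g} (suc zero)    (a ∷ b ∷ S)             x = refl
swapFirstSplit-lookup {suc g} (suc (suc c)) (true ∷ true ∷ S)       x = swapFirstSplit-lookup c S x
swapFirstSplit-lookup {suc g} (suc (suc c)) (false ∷ false ∷ S)     x = swapFirstSplit-lookup c S x
swapFirstSplit-lookup {suc g} (suc (suc c)) (true ∷ false ∷ S)      x = refl
swapFirstSplit-lookup {suc g} (suc (suc c)) (false ∷ true ∷ S)      x = refl

swapFirstSplit-oddSplits : ∀ {g} (e : Fin (suc g)) S → splitOutside e S ≡ true →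
                           oddSplits (swapFirstSplit e S) ≡ not (oddSplits S)
swapFirstSplit-oddSplits {suc g} zero    (a ∷ b ∷ S)         split =
  trans (cong ((a ∧ not b) xor_) (swapFirstSplit-oddSplits (fromℕ g) S split)) (sym (not-distribʳ-xor (a ∧ not b) (oddSplits S)))
swapFirstSplit-oddSplits {suc g} (suc e) (true ∷ true ∷ S)   split = swapFirstSplit-oddSplits e S split
swapFirstSplit-oddSplits {suc g} (suc e) (false ∷ false ∷ S) split = swapFirstSplit-oddSplits e S split
swapFirstSplit-oddSplits {suc g} (suc e) (true ∷ false ∷ S)  split = sym (not-involutive (oddSplits S))
swapFirstSplit-oddSplits {suc g} (suc e) (false ∷ true ∷ S)  split = refl

swapFirstSplit-firstUniform : ∀ {g} (e : Fin (suc g)) S → firstUniform (swapFirstSplit e S) ≡ firstUniform S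
swapFirstSplit-firstUniform {zero}  zero    S                   = refl
swapFirstSplit-firstUniform {suc g} zero    (true ∷ true ∷ S)   = refl
swapFirstSplit-firstUniform {suc g} zero    (false ∷ false ∷ S) = refl
swapFirstSplit-firstUniform {suc g} zero    (true ∷ false ∷ S)  = swapFirstSplit-firstUniform (fromℕ g) S
swapFirstSplit-firstUniform {suc g} zero    (false ∷ true ∷ S)  = swapFirstSplit-firstUniform (fromℕ g) S
swapFirstSplit-firstUniform {suc g} (suc e) (true ∷ true ∷ S)   = refl
swapFirstSplit-firstUniform {suc g} (suc e) (false ∷ false ∷ S) = refl
swapFirstSplit-firstUniform {suc g} (suc e) (true ∷ false ∷ S)  = refl
swapFirstSplit-firstUniform {suc g} (suc e) (false ∷ true ∷ S)  = refl

complementOutside-involutive : ∀ {g} (e : Fin (suc g)) S → complementOutside e (complementOutside e S) ≡ S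
complementOutside-involutive {zero}  zero    S           = refl
complementOutside-involutive {suc g} zero    (a ∷ b ∷ S) = cong (λ S′ → a ∷ b ∷ S′) (complementOutside-involutive (fromℕ g) S)
complementOutside-involutive {suc g} (suc e) (a ∷ b ∷ S) rewrite not-involutive a | not-involutive b =
  cong (λ S′ → a ∷ b ∷ S′) (complementOutside-involutive e S)

complementOutside-splitOutside : ∀ {g} (e : Fin (suc g)) S → splitOutside e (complementOutside e S) ≡ splitOutside e S
complementOutside-splitOutside {zero}  zero    S           = refl
complementOutside-splitOutside {suc g} zero    (a ∷ b ∷ S) = complementOutside-splitOutside (fromℕ g) S
complementOutside-splitOutside {suc g} (suc e) (a ∷ b ∷ S) = cong₂ _∨_ (xor-not-not a b) (complementOutside-splitOutside e S)

complementOutside-isLifted : ∀ {g} (e : Fin (suc g)) S → isLifted (complementOutside e S) ≡ isLifted S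
complementOutside-isLifted {zero}  zero    S           = refl
complementOutside-isLifted {suc g} zero    (a ∷ b ∷ S) = cong (not (a xor b) ∧_) (complementOutside-isLifted (fromℕ g) S)
complementOutside-isLifted {suc g} (suc e) (a ∷ b ∷ S) = cong₂ _∧_ (cong not (xor-not-not a b)) (complementOutside-isLifted e S)

complementOutside-lookup : ∀ {g} (b : Fin (double (suc g))) S x →
                           lookup (complementOutside (half b) S ∷ʳ x) b ≡ lookup (S ∷ʳ x) b
complementOutside-lookup {zero}  zero          (a ∷ [])    x = refl
complementOutside-lookup {zero}  (suc zero)    (a ∷ [])    x = refl
complementOutside-lookup {suc g} zero          (a ∷ b ∷ S) x = refl
complementOutside-lookup {suc g} (suc zero)    (a ∷ b ∷ S) x = refl
complementOutside-lookup {suc g} (suc (suc c)) (a ∷ b ∷ S) x = complementOutside-lookup c S x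

complementOutside-oddSplits : ∀ {g} (e : Fin (suc g)) S → splitOutside e S ≡ false →
                              oddSplits (complementOutside e S) ≡ oddSplits S
complementOutside-oddSplits {zero}  zero    S                   noSplit = refl
complementOutside-oddSplits {suc g} zero    (a ∷ b ∷ S)         noSplit =
  cong ((a ∧ not b) xor_) (complementOutside-oddSplits (fromℕ g) S noSplit)
complementOutside-oddSplits {suc g} (suc e) (true ∷ true ∷ S)   noSplit = complementOutside-oddSplits e S noSplit
complementOutside-oddSplits {suc g} (suc e) (false ∷ false ∷ S) noSplit = complementOutside-oddSplits e S noSplit

noSplit⇒isLifted : ∀ g (S : Paired g) → splitOutside (fromℕ g) S ≡ false → isLifted S ≡ true
noSplit⇒isLifted zero    (x ∷ [])            noSplit = refl
noSplit⇒isLifted (suc g) (true ∷ true ∷ S)   noSplit = noSplit⇒isLifted g S noSplit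
noSplit⇒isLifted (suc g) (false ∷ false ∷ S) noSplit = noSplit⇒isLifted g S noSplit

-- The block e is a pair that S splits, and some other pair exists: it is uniform, and the
-- first uniform pair is the one whose value is complemented.
complementOutside-firstUniform : ∀ {g} (e : Fin (suc (suc (suc g)))) S → splitOutside e S ≡ false → isLifted S ≡ false →
                                 firstUniform (complementOutside e S) ≡ not (firstUniform S)
complementOutside-firstUniform zero (true ∷ true ∷ S) noSplit notLifted
  with () ← trans (sym (noSplit⇒isLifted _ S noSplit)) notLifted
complementOutside-firstUniform zero (false ∷ false ∷ S) noSplit notLifted
  with () ← trans (sym (noSplit⇒isLifted _ S noSplit)) notLifted
complementOutside-firstUniform zero (true ∷ false ∷ true ∷ true ∷ S)    noSplit notLifted = refl
complementOutside-firstUniform zero (true ∷ false ∷ false ∷ false ∷ S)  noSplit notLifted = refl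
complementOutside-firstUniform zero (false ∷ true ∷ true ∷ true ∷ S)    noSplit notLifted = refl
complementOutside-firstUniform zero (false ∷ true ∷ false ∷ false ∷ S)  noSplit notLifted = refl
complementOutside-firstUniform (suc e) (true ∷ true ∷ S)   noSplit notLifted = refl
complementOutside-firstUniform (suc e) (false ∷ false ∷ S) noSplit notLifted = refl

-- f full pairs, f' empty pairs and the extra bit x, when every pair is uniform.
uniform-size : ∀ g (S : Paired g) → splitOutside (fromℕ g) S ≡ false →
               ∃ λ f → ∃ λ f' → ∃ λ x → f + f' ≡ g × ∣ S ∣ ≡ double f + 𝟙 x
                                      × ∣ complementOutside (fromℕ g) S ∣ ≡ double f' + 𝟙 x
uniform-size zero    (true ∷ [])  noSplit = 0 , 0 , true , refl , refl , refl
uniform-size zero    (false ∷ []) noSplit = 0 , 0 , false , refl , refl , refl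
uniform-size (suc g) (true ∷ true ∷ S) noSplit with uniform-size g S noSplit
... | f , f' , x , f+f' , ∣S∣ , ∣S̅∣ = suc f , f' , x , cong suc f+f' , cong (λ n → suc (suc n)) ∣S∣ , ∣S̅∣
uniform-size (suc g) (false ∷ false ∷ S) noSplit with uniform-size g S noSplit
... | f , f' , x , f+f' , ∣S∣ , ∣S̅∣ =
  f , suc f' , x , trans (+-suc f f') (cong suc f+f') , ∣S∣ , cong (λ n → suc (suc n)) ∣S̅∣

-- Sizes 2f+x+1 and 2f'+x+1 with f + f' = 2c: both are 2c+1 exactly when x = 0 and f = f' = c.
odd-size-≡ᵇ : ∀ {f f' c} x → f + f' ≡ double c →
              (suc (double f + 𝟙 x) ≡ᵇ suc (double c)) ≡ (suc (double f' + 𝟙 x) ≡ᵇ suc (double c))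
odd-size-≡ᵇ {f} {f'} {c} true f+f'≡2c
  rewrite +-comm (double f) 1 | +-comm (double f') 1 = trans (odd-≢ᵇ-double f c) (sym (odd-≢ᵇ-double f' c))
odd-size-≡ᵇ {f} {f'} {c} false f+f'≡2c
  rewrite +-identityʳ (double f) | +-identityʳ (double f') | double-≡ᵇ f c | double-≡ᵇ f' c =
  does-⇔ (mk⇔ (λ { refl → +-cancelˡ-≡ c f' c (trans f+f'≡2c (double≡+ c)) })
               (λ { refl → ℕ.+-cancelʳ-≡ c f c (trans f+f'≡2c (double≡+ c)) }))
         (f ℕ.≟ c) (f' ℕ.≟ c)

complementOutside-size : ∀ {g} (e : Fin (suc g)) S → splitOutside e S ≡ false → isLifted S ≡ false →
                         ∃ λ f → ∃ λ f' → ∃ λ x → suc (f + f') ≡ g × ∣ S ∣ ≡ suc (double f + 𝟙 x)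
                                                × ∣ complementOutside e S ∣ ≡ suc (double f' + 𝟙 x)
complementOutside-size {zero}  zero (x ∷ []) noSplit ()
complementOutside-size {suc g} zero (true ∷ true ∷ S) noSplit notLifted
  with () ← trans (sym (noSplit⇒isLifted g S noSplit)) notLifted
complementOutside-size {suc g} zero (false ∷ false ∷ S) noSplit notLifted
  with () ← trans (sym (noSplit⇒isLifted g S noSplit)) notLifted
complementOutside-size {suc g} zero (true ∷ false ∷ S) noSplit notLifted with uniform-size g S noSplit
... | f , f' , x , f+f' , ∣S∣ , ∣S̅∣ = f , f' , x , cong suc f+f' , cong suc ∣S∣ , cong suc ∣S̅∣
complementOutside-size {suc g} zero (false ∷ true ∷ S) noSplit notLifted with uniform-size g S noSplit
... | f , f' , x , f+f' , ∣S∣ , ∣S̅∣ = f , f' , x , cong suc f+f' , cong suc ∣S∣ , cong suc ∣S̅∣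
complementOutside-size {suc g} (suc e) (true ∷ true ∷ S) noSplit notLifted with complementOutside-size e S noSplit notLifted
... | f , f' , x , f+f' , ∣S∣ , ∣S̅∣ = suc f , f' , x , cong suc f+f' , cong (λ n → suc (suc n)) ∣S∣ , ∣S̅∣
complementOutside-size {suc g} (suc e) (false ∷ false ∷ S) noSplit notLifted with complementOutside-size e S noSplit notLifted
... | f , f' , x , f+f' , ∣S∣ , ∣S̅∣ =
  f , suc f' , x , trans (cong suc (+-suc f f')) (cong suc f+f') , ∣S∣ , cong (λ n → suc (suc n)) ∣S̅∣

toggle-involutive : ∀ {g} (e : Fin (suc g)) S → toggle e (toggle e S) ≡ S
toggle-involutive e S with splitOutside e S in split
... | true  rewrite swapFirstSplit-splitOutside e S | split = swapFirstSplit-involutive e S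
... | false rewrite complementOutside-splitOutside e S | split = complementOutside-involutive e S

toggle-isLifted : ∀ {g} (e : Fin (suc g)) S → isLifted (toggle e S) ≡ isLifted S
toggle-isLifted e S with splitOutside e S
... | true  = swapFirstSplit-isLifted e S
... | false = complementOutside-isLifted e S

toggle-lookup : ∀ {g} (b : Fin (double (suc g))) S x → lookup (toggle (half b) S ∷ʳ x) b ≡ lookup (S ∷ʳ x) b
toggle-lookup b S x with splitOutside (half b) S
... | true  = swapFirstSplit-lookup b S x
... | false = complementOutside-lookup b S x

toggle-chosen : ∀ {g} (e : Fin (suc (suc (suc g)))) S → isLifted S ≡ false → chosen (toggle e S) ≡ not (chosen S)
toggle-chosen e S notLifted with splitOutside e S in split
... | true  rewrite swapFirstSplit-oddSplits e S split | swapFirstSplit-firstUniform e S =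
  sym (not-distribˡ-xor (oddSplits S) (firstUniform S))
... | false rewrite complementOutside-oddSplits e S split | complementOutside-firstUniform e S split notLifted =
  sym (not-distribʳ-xor (oddSplits S) (firstUniform S))

toggle-size : ∀ {c} (e : Fin (suc (suc (double c)))) S → isLifted S ≡ false →
              (∣ toggle e S ∣ ≡ᵇ suc (double c)) ≡ (∣ S ∣ ≡ᵇ suc (double c))
toggle-size e S notLifted with splitOutside e S in split
... | true  = cong (_≡ᵇ _) (swapFirstSplit-size e S)
... | false with complementOutside-size e S split notLifted
...   | f , f' , x , f+f' , ∣S∣ , ∣S̅∣ rewrite ∣S∣ | ∣S̅∣ = sym (odd-size-≡ᵇ {f} {f'} x (ℕ.suc-injective f+f'))

unlifted : ∀ {g} → Paired g → Bool
unlifted {g} S = not (isLifted S) ∧ (∣ S ∣ ≡ᵇ g)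

𝟙-split : ∀ r c o → 𝟙 ((r ∧ c) ∧ o) + 𝟙 ((r ∧ not c) ∧ o) ≡ 𝟙 (r ∧ o)
𝟙-split true  true  o = +-identityʳ (𝟙 o)
𝟙-split true  false o = refl
𝟙-split false c     o = refl

-- For an odd number g ≥ 3 of pairs, toggle e is an involution on the unlifted g-sets
-- that flips chosen, so it halves any count invariant under it.
∑-chosen-half : ∀ c (e : Fin (suc (suc (double (suc c))))) (O : Paired (suc (double (suc c))) → Bool) →
                (∀ S → O (toggle e S) ≡ O S) →
                double (∑ _ (λ S → 𝟙 ((unlifted S ∧ chosen S) ∧ O S))) ≡ ∑ _ (λ S → 𝟙 (unlifted S ∧ O S))
∑-chosen-half c e O O-invariant = begin
  double (∑ N chosenO)                                  ≡⟨ double≡+ (∑ N chosenO) ⟩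
  ∑ N chosenO + ∑ N chosenO                             ≡⟨ cong (∑ N chosenO +_) (sym (∑-involution N (toggle e) (toggle-involutive e) chosenO)) ⟩
  ∑ N chosenO + ∑ N (λ S → chosenO (toggle e S))        ≡⟨ cong (∑ N chosenO +_) (∑-cong N (λ S → cong 𝟙 (toggled S))) ⟩
  ∑ N chosenO + ∑ N unchosenO                           ≡⟨ sym (∑-distrib-+ N chosenO unchosenO) ⟩
  ∑ N (λ S → chosenO S + unchosenO S)                   ≡⟨ ∑-cong N (λ S → 𝟙-split (unlifted S) (chosen S) (O S)) ⟩
  ∑ N (λ S → 𝟙 (unlifted S ∧ O S))                     ∎
  where
  open ≡-Reasoning
  N = suc (double (suc (double (suc c))))
  chosenO unchosenO : Paired (suc (double (suc c))) → ℕ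
  chosenO   S = 𝟙 ((unlifted S ∧ chosen S) ∧ O S)
  unchosenO S = 𝟙 ((unlifted S ∧ not (chosen S)) ∧ O S)
  toggled : ∀ S → (unlifted (toggle e S) ∧ chosen (toggle e S)) ∧ O (toggle e S) ≡ (unlifted S ∧ not (chosen S)) ∧ O S
  toggled S rewrite toggle-isLifted e S | O-invariant S with isLifted S in lifted
  ... | true  = refl
  ... | false rewrite toggle-size e S lifted | toggle-chosen e S lifted = refl

-- The doubling step

-- The degree of b in the family with a new point, contained in every member, appended to
-- the ground set: for b = fromℕ m this is the number of members.
degree⁺ : ∀ {m} → List (Subset m) → Fin (suc m) → ℕ
degree⁺ Q b = countᵇ (λ S → lookup (S ∷ʳ true) b) Q

offset : ∀ {m} → ℕ → Fin m → ℕ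
offset t b = if toℕ b <ᵇ t then 1 else 3

offset-high : ∀ {m} t (b : Fin m) → t ≤ toℕ b → offset t b ≡ 3
offset-high t b t≤b = cong (λ lt → if lt then 1 else 3) (≤⇒<ᵇ-false t≤b)

offset-low : ∀ {m} t (b : Fin m) → toℕ b < t → offset t b ≡ 1
offset-low t b b<t = cong (λ lt → if lt then 1 else 3) (dec-true (toℕ b <? t) b<t)

half-<ᵇ : ∀ {m} (b : Fin (double m)) t → (toℕ b <ᵇ double t) ≡ (toℕ (half b) <ᵇ t)
half-<ᵇ {suc m} zero          zero    = refl
half-<ᵇ {suc m} zero          (suc t) = refl
half-<ᵇ {suc m} (suc zero)    zero    = refl
half-<ᵇ {suc m} (suc zero)    (suc t) = refl
half-<ᵇ {suc m} (suc (suc b)) zero    = refl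
half-<ᵇ {suc m} (suc (suc b)) (suc t) = half-<ᵇ b t

offset-half : ∀ {m} t (b : Fin (double m)) → offset (double t) b ≡ offset t (half b)
offset-half t b = cong (λ lt → if lt then 1 else 3) (half-<ᵇ b t)

-- A position q (counted from 0) relative to the quarter points h, 2h, 3h of [4h-1].
byQuarters : (Bool → Bool → Bool → Bool) → ℕ → ℕ → Bool
byQuarters F h q = F (q <ᵇ h) (q <ᵇ double h) (q <ᵇ 3 * h)

quarterSet : ∀ {m} → (Bool → Bool → Bool → Bool) → ℕ → Subset m
quarterSet F h = tabulate (λ i → byQuarters F h (toℕ i))

byQuarters-double : ∀ F h q → byQuarters F (double h) (double q) ≡ byQuarters F h q
byQuarters-double F h q rewrite 3*-double h | double-<ᵇ q h | double-<ᵇ q (double h) | double-<ᵇ q (3 * h) = refl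

byQuarters-odd : ∀ F h q → byQuarters F (double h) (suc (double q)) ≡ byQuarters F h q
byQuarters-odd F h q rewrite 3*-double h | odd-<ᵇ q h | odd-<ᵇ q (double h) | odd-<ᵇ q (3 * h) = refl

byQuarters-last : ∀ F h q → 3 * h ≤ q → F false false false ≡ true → byQuarters F h q ≡ true
byQuarters-last F h q 3h≤q Ffff
  rewrite ≤⇒<ᵇ-false (ℕ.≤-trans (ℕ.m≤n*m h 3) 3h≤q)
        | ≤⇒<ᵇ-false (ℕ.≤-trans (double≤3* h) 3h≤q)
        | ≤⇒<ᵇ-false 3h≤q = Ffff

tabulate-lift : ∀ n (p q : ℕ → Bool) → (∀ j → p (double j) ≡ q j) → (∀ j → p (suc (double j)) ≡ q j) →
                p (double n) ≡ true → tabulate {n = suc (double n)} (λ i → p (toℕ i)) ≡ lift (tabulate (λ j → q (toℕ j))) true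
tabulate-lift zero    p q even odd last = cong (_∷ []) last
tabulate-lift (suc n) p q even odd last = cong₂ _∷_ (even 0) (cong₂ _∷_ (odd 0)
  (tabulate-lift n (λ j → p (suc (suc j))) (λ j → q (suc j)) (λ j → even (suc j)) (λ j → odd (suc j)) last))

quarterSet-double : ∀ n F h → 3 * h ≤ n → F false false false ≡ true →
                    quarterSet {suc (double n)} F (double h) ≡ lift (quarterSet F h) true
quarterSet-double n F h 3h≤n Ffff = tabulate-lift n (byQuarters F (double h)) (byQuarters F h)
  (byQuarters-double F h) (byQuarters-odd F h)
  (byQuarters-last F (double h) (double n) (subst (_≤ double n) (sym (3*-double h)) (double-mono-≤ 3h≤n)) Ffff)

-- The family for k = 2(a+1) on [2k-1].  At a point, balanced says 2 d'(i) + (1 or 3) equals the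
-- number of (k-1)-sets through it; at the appended point it says 2 |Q| + 3 = C(2k-1, k-1).
record Construction (a : ℕ) : Set where
  field
    family   : List (Paired (suc (double a)))
    unique   : Unique family
    sizes    : All (λ S → ∣ S ∣ ≡ suc (double a)) family
    balanced : ∀ b → double (degree⁺ family b) + offset (3 * suc a) b
                     ≡ ∑ _ (λ T → 𝟙 ((∣ T ∣ ≡ᵇ suc (double a)) ∧ lookup (T ∷ʳ true) b))
    avoids   : ∀ F → F false false false ≡ true → quarterSet F (suc a) ∉ family

construction₀ : Construction 0
construction₀ = record
  { family   = []
  ; unique   = []
  ; sizes    = []
  ; balanced = λ { zero → refl ; (suc zero) → refl ; (suc (suc zero)) → refl ; (suc (suc (suc zero))) → refl }
  ; avoids   = λ F _ ()
  }

selected : ∀ {g} → Paired g → Bool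
selected S = unlifted S ∧ chosen S

selected-lift : ∀ {g} (T : Vec Bool g) x → selected (lift T x) ≡ false
selected-lift T x rewrite isLifted-lift T x = refl

selected⇒size : ∀ {g} (S : Paired g) → T (selected S) → ∣ S ∣ ≡ g
selected⇒size {g} S sel =
  ℕ.≡ᵇ⇒≡ ∣ S ∣ g (proj₂ (Equivalence.to (T-∧ {not (isLifted S)}) (proj₁ (Equivalence.to (T-∧ {unlifted S}) sel))))

-- From a family for k on [n] = [2k-1] to one for 2k on [2n+1] = [4k-1].
doubled : ∀ {r} → List (Paired r) → List (Paired (suc (double r)))
doubled Q = filter (λ S → T? (selected S)) (subsets _) ++ map (λ T → lift T true) Q

module _ {c} (Q : List (Paired (suc c))) where

  private
    r n : ℕ
    r = suc c
    n = suc (double r)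
    chosenSets : List (Paired n)
    chosenSets = filter (λ S → T? (selected S)) (subsets (suc (double n)))

  doubled-unique : Unique Q → Unique (doubled Q)
  doubled-unique unique-Q = Unique.++⁺ (Unique.filter⁺ (λ S → T? (selected S)) (subsets-unique _))
                                       (Unique.map⁺ (lift-injective _ _ true) unique-Q) disjoint
    where
    disjoint : ∀ {S : Paired n} → S ∈ chosenSets × S ∈ map (λ T → lift T true) Q → ⊥
    disjoint (S∈chosen , S∈lifted) with ∈-map⁻ (λ T → lift T true) S∈lifted
    ... | U , _ , refl = subst T (selected-lift U true)
                               (proj₂ (∈-filter⁻ (λ S → T? (selected S)) {xs = subsets _} S∈chosen))

  doubled-sizes : All (λ T → ∣ T ∣ ≡ r) Q → All (λ S → ∣ S ∣ ≡ n) (doubled Q)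
  doubled-sizes sizes-Q = All.++⁺
    (All.map (λ {S} → selected⇒size S) (All.all-filter (λ S → T? (selected S)) (subsets _)))
    (All.map⁺ (All.map (λ {T} ∣T∣≡r → trans (∣lift-true∣ T) (cong (suc ∘ double) ∣T∣≡r)) sizes-Q))

  degree⁺-doubled : ∀ (b : Fin (double (suc n))) →
                    degree⁺ (doubled Q) b ≡ ∑ _ (λ S → 𝟙 (selected S ∧ lookup (S ∷ʳ true) b)) + degree⁺ Q (half b)
  degree⁺-doubled b = begin
    countᵇ O (chosenSets ++ map (λ T → lift T true) Q)
      ≡⟨ countᵇ-++ O chosenSets (map (λ T → lift T true) Q) ⟩
    countᵇ O chosenSets + countᵇ O (map (λ T → lift T true) Q)
      ≡⟨ cong₂ _+_ (countᵇ-filter (λ S → T? (selected S)) O (subsets _)) (countᵇ-map O (λ T → lift T true) Q) ⟩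
    countᵇ (λ S → selected S ∧ O S) (subsets _) + countᵇ (λ T → O (lift T true)) Q
      ≡⟨ cong₂ _+_ (countᵇ-subsets _ (λ S → selected S ∧ O S)) (countᵇ-cong (λ T → lookup-lift-∷ʳ T true b) Q) ⟩
    ∑ _ (λ S → 𝟙 (selected S ∧ O S)) + degree⁺ Q (half b) ∎
    where
    open ≡-Reasoning
    O : Paired n → Bool
    O S = lookup (S ∷ʳ true) b

  ∑-lifted-size : ∀ (b : Fin (double (suc n))) →
                  ∑ _ (λ S → if isLifted S then 𝟙 ((∣ S ∣ ≡ᵇ n) ∧ lookup (S ∷ʳ true) b) else 0)
                  ≡ ∑ _ (λ T → 𝟙 ((∣ T ∣ ≡ᵇ r) ∧ lookup (T ∷ʳ true) (half b)))
  ∑-lifted-size b = trans (∑-lifted n (λ S → 𝟙 ((∣ S ∣ ≡ᵇ n) ∧ lookup (S ∷ʳ true) b))) (∑-cong n lifted-true)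
    where
    lifted-true : ∀ T → 𝟙 ((∣ lift T true ∣ ≡ᵇ n) ∧ lookup (lift T true ∷ʳ true) b)
                        + 𝟙 ((∣ lift T false ∣ ≡ᵇ n) ∧ lookup (lift T false ∷ʳ true) b)
                      ≡ 𝟙 ((∣ T ∣ ≡ᵇ r) ∧ lookup (T ∷ʳ true) (half b))
    lifted-true T rewrite ∣lift-true∣ T | ∣lift-false∣ T | double-≡ᵇ ∣ T ∣ r | double-≢ᵇ-odd ∣ T ∣ r
                        | lookup-lift-∷ʳ T true b = +-identityʳ _

  doubled-balanced : ∀ h →
                     (∀ b → double (degree⁺ Q b) + offset (3 * h) b ≡ ∑ n (λ T → 𝟙 ((∣ T ∣ ≡ᵇ r) ∧ lookup (T ∷ʳ true) b))) →
                     ∀ (b : Fin (double (suc n))) →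
                     double (degree⁺ (doubled Q) b) + offset (3 * double h) b
                     ≡ ∑ _ (λ S → 𝟙 ((∣ S ∣ ≡ᵇ n) ∧ lookup (S ∷ʳ true) b))
  doubled-balanced h balanced b = begin
    double (degree⁺ (doubled Q) b) + offset (3 * double h) b
      ≡⟨ cong₂ _+_ (cong double (degree⁺-doubled b)) (trans (cong (λ t → offset t b) (3*-double h)) (offset-half (3 * h) b)) ⟩
    double (X + degree⁺ Q (half b)) + offset (3 * h) (half b)
      ≡⟨ cong (_+ offset (3 * h) (half b)) (double-distrib-+ X (degree⁺ Q (half b))) ⟩
    double X + double (degree⁺ Q (half b)) + offset (3 * h) (half b)
      ≡⟨ +-assoc (double X) _ _ ⟩
    double X + (double (degree⁺ Q (half b)) + offset (3 * h) (half b))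
      ≡⟨ cong₂ _+_ (∑-chosen-half c (half b) O (λ S → toggle-lookup b S true)) (balanced (half b)) ⟩
    ∑ _ (λ S → 𝟙 (unlifted S ∧ O S)) + ∑ n (λ T → 𝟙 ((∣ T ∣ ≡ᵇ r) ∧ lookup (T ∷ʳ true) (half b)))
      ≡⟨ cong (∑ _ (λ S → 𝟙 (unlifted S ∧ O S)) +_) (sym (∑-lifted-size b)) ⟩
    ∑ _ (λ S → 𝟙 (unlifted S ∧ O S)) + ∑ _ (λ S → if isLifted S then 𝟙 ((∣ S ∣ ≡ᵇ n) ∧ O S) else 0)
      ≡⟨ sym (∑-distrib-+ _ (λ S → 𝟙 (unlifted S ∧ O S))
                            (λ S → if isLifted S then 𝟙 ((∣ S ∣ ≡ᵇ n) ∧ O S) else 0)) ⟩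
    ∑ _ (λ S → 𝟙 (unlifted S ∧ O S) + (if isLifted S then 𝟙 ((∣ S ∣ ≡ᵇ n) ∧ O S) else 0))
      ≡⟨ ∑-cong _ unlifted-or-lifted ⟩
    ∑ _ (λ S → 𝟙 ((∣ S ∣ ≡ᵇ n) ∧ O S)) ∎
    where
    open ≡-Reasoning
    O : Paired n → Bool
    O S = lookup (S ∷ʳ true) b
    X = ∑ _ (λ S → 𝟙 (selected S ∧ O S))
    unlifted-or-lifted : ∀ S → 𝟙 (unlifted S ∧ O S) + (if isLifted S then 𝟙 ((∣ S ∣ ≡ᵇ n) ∧ O S) else 0)
                               ≡ 𝟙 ((∣ S ∣ ≡ᵇ n) ∧ O S)
    unlifted-or-lifted S with isLifted S
    ... | true  = refl
    ... | false = +-identityʳ _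

  doubled-avoids : ∀ h → 3 * h ≤ n → ∀ F → F false false false ≡ true →
                   quarterSet F h ∉ Q → quarterSet F (double h) ∉ doubled Q
  doubled-avoids h 3h≤n F Ffff ∉Q ∈doubled rewrite quarterSet-double n F h 3h≤n Ffff
    with ∈-++⁻ chosenSets ∈doubled
  ... | inj₁ ∈chosen = subst T (selected-lift (quarterSet {n} F h) true)
                             (proj₂ (∈-filter⁻ (λ S → T? (selected S)) {xs = subsets _} ∈chosen))
  ... | inj₂ ∈lifted with ∈-map⁻ (λ T → lift T true) ∈lifted
  ...   | U , U∈Q , eq = ∉Q (subst (_∈ Q) (sym (lift-injective _ U true eq)) U∈Q)

construction-step : ∀ {a} → Construction a → Construction (suc (double a))
construction-step {a} C = record
  { family   = doubled family
  ; unique   = doubled-unique family unique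
  ; sizes    = doubled-sizes family sizes
  ; balanced = doubled-balanced family (suc a) balanced
  ; avoids   = λ F Ffff → doubled-avoids family (suc a) (3h≤4h-1 a) F Ffff (avoids F Ffff)
  }
  where open Construction C

mersenne : ℕ → ℕ
mersenne zero    = zero
mersenne (suc s) = suc (double (mersenne s))

construction : ∀ s → Construction (mersenne s)
construction zero    = construction₀
construction (suc s) = construction-step (construction s)

suc-mersenne : ∀ s → suc (mersenne s) ≡ 2 ^ s
suc-mersenne zero    = refl
suc-mersenne (suc s) = trans (cong double (suc-mersenne s)) (sym (2*≡double (2 ^ s)))

does-∈?≡lookup : ∀ {m} (i : Fin m) (S : Subset m) → does (i ∈? S) ≡ lookup S i
does-∈?≡lookup zero    (true ∷ S)  = refl
does-∈?≡lookup zero    (false ∷ S) = refl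
does-∈?≡lookup (suc i) (x ∷ S)     = does-∈?≡lookup i S

lookup-∷ʳ-inject₁ : ∀ {m} (S : Subset m) x (i : Fin m) → lookup (S ∷ʳ x) (inject₁ i) ≡ lookup S i
lookup-∷ʳ-inject₁ (y ∷ S) x zero    = refl
lookup-∷ʳ-inject₁ (y ∷ S) x (suc i) = lookup-∷ʳ-inject₁ S x i

lookup-∷ʳ-fromℕ : ∀ {m} (S : Subset m) x → lookup (S ∷ʳ x) (fromℕ m) ≡ x
lookup-∷ʳ-fromℕ []      x = refl
lookup-∷ʳ-fromℕ (y ∷ S) x = lookup-∷ʳ-fromℕ S x

degree⁺-inject₁ : ∀ {m} (Q : List (Subset m)) i → degree⁺ Q (inject₁ i) ≡ degree Q i
degree⁺-inject₁ Q i = sym (trans (length-filter≡countᵇ (i ∈?_) Q)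
  (countᵇ-cong (λ S → trans (does-∈?≡lookup i S) (sym (lookup-∷ʳ-inject₁ S true i))) Q))

degree⁺-fromℕ : ∀ {m} (Q : List (Subset m)) → degree⁺ Q (fromℕ m) ≡ length Q
degree⁺-fromℕ []      = refl
degree⁺-fromℕ (S ∷ Q) rewrite lookup-∷ʳ-fromℕ S true = cong suc (degree⁺-fromℕ Q)

∑-size-last : ∀ m r → ∑ m (λ T → 𝟙 ((∣ T ∣ ≡ᵇ r) ∧ lookup (T ∷ʳ true) (fromℕ m))) ≡ m C r
∑-size-last m r = trans (∑-cong m (λ T → cong 𝟙 (trans (cong ((∣ T ∣ ≡ᵇ r) ∧_) (lookup-∷ʳ-fromℕ T true)) (∧-identityʳ _))))
                        (∑-size≡C m r)

∑-size-inject₁ : ∀ m r i → ∑ (suc m) (λ T → 𝟙 ((∣ T ∣ ≡ᵇ suc r) ∧ lookup (T ∷ʳ true) (inject₁ i))) ≡ m C r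
∑-size-inject₁ m r i = trans (∑-cong (suc m) (λ T → cong (λ x → 𝟙 ((∣ T ∣ ≡ᵇ suc r) ∧ x)) (lookup-∷ʳ-inject₁ T true i)))
                             (∑-size-∋≡C m r i)

if-true-else-false : ∀ b → (if b then true else false) ≡ b
if-true-else-false true  = refl
if-true-else-false false = refl

inInterval-suc : ∀ c d q → inInterval (c + 1) d (suc q) ≡ not (q <ᵇ c) ∧ (q <ᵇ d)
inInterval-suc c d q = cong₂ _∧_
  (trans (isYes≗does (c + 1 ≤? suc q)) (does-⇔ (mk⇔ to from) (c + 1 ≤? suc q) (¬? (q <? c))))
  (isYes≗does (suc q ≤? d))
  where
  to : c + 1 ≤ suc q → ¬ (q < c)
  to c+1≤1+q = ℕ.≤⇒≯ (ℕ.≤-pred (subst (_≤ suc q) (+-comm c 1) c+1≤1+q))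
  from : ¬ (q < c) → c + 1 ≤ suc q
  from q≮c = subst (_≤ suc q) (+-comm 1 c) (s≤s (ℕ.≮⇒≥ q≮c))

fromPred≡quarterSet : ∀ {m} (p : ℕ → Bool) F h → (∀ q → q < m → p (suc q) ≡ byQuarters F h q) →
                      fromPred {m} p ≡ quarterSet F h
fromPred≡quarterSet p F h p≗F = tabulate-cong (λ i → trans (if-true-else-false (p (label i))) (p≗F (toℕ i) (toℕ<n i)))

-- The statement for k with the ground set [2k-1] abstracted to [m], so that it can be transported.
GoodFamily : ℕ → ℕ → Set
GoodFamily k m = Σ (List (Subset m)) λ Q →
  Unique Q
  × All (λ S → ∣ S ∣ ≡ k ∸ 1) Q
  × (2 * length Q + 3 ≡ (2 * k ∸ 1) C (k ∸ 1))
  × (∃ λ c → ∀ (i : Fin m) →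
       (label i ≤ 3 * k / 2 → degree Q i ≡ suc c)
       × (label i > 3 * k / 2 → degree Q i ≡ c))
  × fromPred {m} (inInterval (k + 1) (2 * k ∸ 1)) ∉ Q
  × fromPred {m} (λ x → inInterval 1 (k / 2) x ∨ inInterval (3 * k / 2 + 1) (2 * k ∸ 1) x) ∉ Q
  × fromPred {m} (λ x → inInterval (k / 2 + 1) k x ∨ inInterval (3 * k / 2 + 1) (2 * k ∸ 1) x) ∉ Q

module _ {a} (built : Construction (suc a)) where

  open Construction built

  private
    h k r n : ℕ
    h = suc (suc a)
    k = double h
    r = suc (double (suc a))
    n = suc (double r)

    k/2≡h : k / 2 ≡ h
    k/2≡h = double-/2 h

    3k/2≡3h : 3 * k / 2 ≡ 3 * h
    3k/2≡3h = trans (cong (_/ 2) (3*-double h)) (double-/2 (3 * h))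

  length-identity : 2 * length family + 3 ≡ (2 * k ∸ 1) C (k ∸ 1)
  length-identity = begin
    2 * length family + 3                        ≡⟨ cong (_+ 3) (trans (2*≡double _) (cong double (sym (degree⁺-fromℕ family)))) ⟩
    double (degree⁺ family (fromℕ n)) + 3       ≡⟨ cong (double (degree⁺ family (fromℕ n)) +_) (sym last-offset) ⟩
    double (degree⁺ family (fromℕ n)) + offset (3 * h) (fromℕ n)
                                                 ≡⟨ balanced (fromℕ n) ⟩
    ∑ n (λ T → 𝟙 ((∣ T ∣ ≡ᵇ r) ∧ lookup (T ∷ʳ true) (fromℕ n)))
                                                 ≡⟨ ∑-size-last n r ⟩
    n C r                                        ≡⟨ cong (_C r) (sym (2*double∸1 (suc a))) ⟩
    (2 * k ∸ 1) C (k ∸ 1)                        ∎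
    where
    open ≡-Reasoning
    last-offset : offset (3 * h) (fromℕ n) ≡ 3
    last-offset = offset-high (3 * h) (fromℕ n) (subst (3 * h ≤_) (sym (toℕ-fromℕ n)) (3h≤4h-1 (suc a)))

  degree-equation : ∀ i → double (degree family i) + offset (3 * h) (inject₁ i) ≡ double r C double (suc a)
  degree-equation i = begin
    double (degree family i) + offset (3 * h) (inject₁ i)
      ≡⟨ cong (λ d → double d + offset (3 * h) (inject₁ i)) (sym (degree⁺-inject₁ family i)) ⟩
    double (degree⁺ family (inject₁ i)) + offset (3 * h) (inject₁ i)
      ≡⟨ balanced (inject₁ i) ⟩
    ∑ n (λ T → 𝟙 ((∣ T ∣ ≡ᵇ r) ∧ lookup (T ∷ʳ true) (inject₁ i)))
      ≡⟨ ∑-size-inject₁ (double r) (double (suc a)) i ⟩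
    double r C double (suc a) ∎
    where open ≡-Reasoning

  -- c is the degree of the last point 2k-1 > 3k/2.
  common-degree : ∃ λ c → ∀ (i : Fin n) → (label i ≤ 3 * k / 2 → degree family i ≡ suc c)
                                         × (label i > 3 * k / 2 → degree family i ≡ c)
  common-degree = degree family last , λ i → low i , high i
    where
    open ≡-Reasoning
    last : Fin n
    last = fromℕ (double r)
    c = degree family last
    last-equation : double c + 3 ≡ double r C double (suc a)
    last-equation = trans (cong (double c +_) (sym (offset-high (3 * h) (inject₁ last) 3h≤last))) (degree-equation last)
      where
      3h≤last : 3 * h ≤ toℕ (inject₁ last)
      3h≤last = subst (3 * h ≤_) (sym (trans (toℕ-inject₁ last) (toℕ-fromℕ (double r)))) (3h≤4h-2 a)
    low : ∀ i → label i ≤ 3 * k / 2 → degree family i ≡ suc c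
    low i label≤ = double-injective (ℕ.suc-injective (begin
      suc (double (degree family i))                        ≡⟨ +-comm 1 _ ⟩
      double (degree family i) + 1                          ≡⟨ cong (double (degree family i) +_) (sym (offset-low (3 * h) (inject₁ i) i<3h)) ⟩
      double (degree family i) + offset (3 * h) (inject₁ i) ≡⟨ degree-equation i ⟩
      double r C double (suc a)                             ≡⟨ sym last-equation ⟩
      double c + 3                                          ≡⟨ +-comm (double c) 3 ⟩
      suc (double (suc c))                                  ∎))
      where
      i<3h : toℕ (inject₁ i) < 3 * h
      i<3h = subst₂ _≤_ (cong suc (sym (toℕ-inject₁ i))) 3k/2≡3h label≤
    high : ∀ i → label i > 3 * k / 2 → degree family i ≡ c
    high i label> = double-injective (ℕ.+-cancelʳ-≡ 3 _ _ (begin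
      double (degree family i) + 3                          ≡⟨ cong (double (degree family i) +_) (sym (offset-high (3 * h) (inject₁ i) 3h≤i)) ⟩
      double (degree family i) + offset (3 * h) (inject₁ i) ≡⟨ degree-equation i ⟩
      double r C double (suc a)                             ≡⟨ sym last-equation ⟩
      double c + 3                                          ∎))
      where
      3h≤i : 3 * h ≤ toℕ (inject₁ i)
      3h≤i = subst₂ _≤_ 3k/2≡3h (sym (toℕ-inject₁ i)) (ℕ.≤-pred label>)

  -- With quarters Q₁, …, Q₄ of [2k-1]: A₁ = Q₃ ∪ Q₄, A₂ = Q₁ ∪ Q₄, A₃ = Q₂ ∪ Q₄.
  F₁ F₂ F₃ : Bool → Bool → Bool → Bool
  F₁ _ y _ = not y
  F₂ x _ z = x ∨ not z
  F₃ x y z = (not x ∧ y) ∨ not z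

  below-end : ∀ q → q < n → (q <ᵇ 2 * k ∸ 1) ≡ true
  below-end q q<n = dec-true (q <? 2 * k ∸ 1) (subst (q <_) (sym (2*double∸1 (suc a))) q<n)

  upper-quarter : ∀ q → q < n → inInterval (3 * k / 2 + 1) (2 * k ∸ 1) (suc q) ≡ not (q <ᵇ 3 * h)
  upper-quarter q q<n = trans (inInterval-suc (3 * k / 2) (2 * k ∸ 1) q)
    (trans (cong₂ (λ t b → not (q <ᵇ t) ∧ b) 3k/2≡3h (below-end q q<n)) (∧-identityʳ _))

  A₁-quarters : fromPred {n} (inInterval (k + 1) (2 * k ∸ 1)) ≡ quarterSet F₁ h
  A₁-quarters = fromPred≡quarterSet (inInterval (k + 1) (2 * k ∸ 1)) F₁ h λ q q<n →
    trans (inInterval-suc k (2 * k ∸ 1) q) (trans (cong (not (q <ᵇ k) ∧_) (below-end q q<n)) (∧-identityʳ _))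

  A₂-quarters : fromPred {n} (λ x → inInterval 1 (k / 2) x ∨ inInterval (3 * k / 2 + 1) (2 * k ∸ 1) x)
                ≡ quarterSet F₂ h
  A₂-quarters = fromPred≡quarterSet (λ x → inInterval 1 (k / 2) x ∨ inInterval (3 * k / 2 + 1) (2 * k ∸ 1) x)
                                    F₂ h λ q q<n →
    cong₂ _∨_ (trans (inInterval-suc 0 (k / 2) q) (cong (q <ᵇ_) k/2≡h)) (upper-quarter q q<n)

  A₃-quarters : fromPred {n} (λ x → inInterval (k / 2 + 1) k x ∨ inInterval (3 * k / 2 + 1) (2 * k ∸ 1) x)
                ≡ quarterSet F₃ h
  A₃-quarters = fromPred≡quarterSet (λ x → inInterval (k / 2 + 1) k x ∨ inInterval (3 * k / 2 + 1) (2 * k ∸ 1) x)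
                                    F₃ h λ q q<n →
    cong₂ _∨_ (trans (inInterval-suc (k / 2) k q) (cong (λ t → not (q <ᵇ t) ∧ (q <ᵇ k)) k/2≡h)) (upper-quarter q q<n)

  good-family : GoodFamily k n
  good-family = family , unique , sizes , length-identity , common-degree
              , subst (_∉ family) (sym A₁-quarters) (avoids F₁ refl)
              , subst (_∉ family) (sym A₂-quarters) (avoids F₂ refl)
              , subst (_∉ family) (sym A₃-quarters) (avoids F₃ refl)

lemma26 : (k : ℕ) → (∃ λ t → k ≡ 2 ^ t) → 4 ≤ k →
  Σ (List (Subset (2 * k ∸ 1))) λ Q →
    Unique Q
    × All (λ S → ∣ S ∣ ≡ k ∸ 1) Q
    × (2 * Data.List.length Q + 3 ≡ (2 * k ∸ 1) C (k ∸ 1))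
    × (∃ λ c → ∀ (i : Fin (2 * k ∸ 1)) →
         (label i ≤ 3 * k / 2 → degree Q i ≡ suc c)
         × (label i > 3 * k / 2 → degree Q i ≡ c))
    × A₁ k ∉ Q × A₂ k ∉ Q × A₃ k ∉ Q
lemma26 k (zero , refl) (s≤s ())
lemma26 k (suc zero , refl) (s≤s (s≤s ()))
lemma26 k (suc (suc s) , k≡2^t) _ =
  subst (λ k → GoodFamily k (2 * k ∸ 1)) (sym k≡2h)
        (subst (GoodFamily (double h)) (sym (2*double∸1 (mersenne (suc s)))) (good-family (construction (suc s))))
  where
  h = suc (mersenne (suc s))
  k≡2h : k ≡ double h
  k≡2h = trans k≡2^t (trans (2*≡double (2 ^ suc s)) (cong double (sym (suc-mersenne (suc s)))))
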